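{- Let $p\ge 5$ be a prime. Then $$\sum_{k=0}^{\lfloor (p-1)/3\rfloor}\binom{3k}{k,k,k}\frac{3^{ -3k}}{k+1}\equiv 0 \pmod p \qquad\text{and}\qquad \sum_{k=0}^{\lfloor (p-2)/3\rfloor}\binom{3k+1}{k,k,k+1}\frac{3^{ -3k}}{k+2}\equiv 0 \pmod p.$$
   Context: $\binom{3k}{k,k,k}=\frac{(3k)!}{(k!)^3}$ and $\binom{3k+1}{k,k,k+1}=\frac{(3k+1)!}{(k!)^2(k+1)!}$. For rational numbers $x,y$ whose denominators are prime to $p$, $x\equiv y \pmod{p^t}$ means $x-y\in p^t\mathbb{Z}_{(p)}$. -}

module Defs where

open import Data.Nat as ℕ using (ℕ; zero; suc; _*_; _^_; _/_; NonZero)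
open import Data.Nat.Properties using (m*n≢0; m^n≢0; _!≢0)
open import Data.Nat using (_!)
open import Data.Integer as ℤ using (ℤ; +_)
import Data.Integer.Divisibility as ℤD
open import Data.Rational as ℚ using (ℚ; 0ℚ)
open import Data.Product using (Σ; ∃; _×_; _,_)
open import Relation.Nullary using (¬_)
open import Relation.Binary.PropositionalEquality using (_≡_)

sumTo : ℕ → (ℕ → ℚ) → ℚ
sumTo zero    f = f 0
sumTo (suc n) f = sumTo n f ℚ.+ f (suc n)

private
  nz3 : ∀ a b c → NonZero (a ! * b ! * c !)
  nz3 a b c = m*n≢0 (a ! * b !) (c !) {{m*n≢0 (a !) (b !) {{a !≢0}} {{b !≢0}}}} {{c !≢0}}

  nzPow : ∀ k → NonZero (27 ^ k)
  nzPow k = m^n≢0 27 k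

multinom3 : ℕ → ℕ → ℕ → ℚ
multinom3 a b c = ℚ._/_ (+ ((a ℕ.+ b ℕ.+ c) !)) (a ! * b ! * c !) {{nz3 a b c}}

-- 3^{-3k} = 1 / 27^k
inv27^ : ℕ → ℚ
inv27^ k = ℚ._/_ (+ 1) (27 ^ k) {{nzPow k}}

invSuc : ℕ → ℚ
invSuc m = (+ 1) ℚ./ (suc m)

-- x ≡ 0 (mod p) for a rational x: x ∈ p ℤ_(p), i.e. x = a / b with
-- integers a, b, p ∤ b and p ∣ a (written as x * b = a).
≡0modℚ : ℕ → ℚ → Set
≡0modℚ p x = Σ ℤ λ a → Σ ℤ λ b →
  (¬ ((+ p) ℤD.∣ b)) × ((+ p) ℤD.∣ a) × (x ℚ.* (b ℚ./ 1) ≡ a ℚ./ 1)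

module Submission where

-- Both congruences follow from exact closed forms of the partial sums,
-- obtained by telescoping:
--   Σ_{k≤n} C(3k;k,k,k) 27^{-k}/(k+1)     = 9(n+1)·(3n+3)! / (2·(n+1)!³·27^{n+1}),
--   Σ_{k≤n} C(3k+1;k,k,k+1) 27^{-k}/(k+2) = 9(n+1)·(3n+4)! / (8·(n+1)!²(n+2)!·27^{n+1}).
-- For n = ⌊(p-1)/3⌋ (resp. ⌊(p-2)/3⌋) the numerator contains the factor
-- (3n+3)! (resp. (3n+4)!) with 3n+3 ≥ p (resp. 3n+4 ≥ p), so p divides it,
-- whereas every factor of the denominator is a power of 2 or 3 or a
-- factorial of a number below p, so p does not divide it.

open import Defs
open import Data.Nat using (ℕ; _≤_; _+_; _∸_; _/_)
open import Data.Nat.Primality using (Prime)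
open import Data.Rational using (_*_)
open import Data.Product using (_×_; _,_)

open import Data.Nat using () renaming (_*_ to _·_)
open import Data.Nat as ℕ using (zero; suc; NonZero; _<_; _!; _^_; z≤n; s≤s)
open import Data.Nat.Properties as ℕP using (m*n≢0; m^n≢0; _!≢0; +-comm)
open import Data.Nat.Divisibility using (_∣_; ∣-trans; m∣m*n; ∣n⇒∣m*n; >⇒∤; m≤n⇒m!∣n!)
open import Data.Nat.DivMod using (_%_; m≡m%n+[m/n]*n; m%n<n; m/n<m)
open import Data.Nat.Primality using (euclidsLemma; prime⇒nonTrivial)
import Data.Nat.Tactic.RingSolver as ℕSolver
open import Data.Integer as ℤ using (+_)
open import Data.Integer.Properties using (pos-*; pos-+)
import Data.Integer.Tactic.RingSolver as ℤSolver
open import Data.Rational as ℚ using (ℚ; fromℚᵘ)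
open import Data.Rational.Properties
  using (toℚᵘ-homo-*; toℚᵘ-homo-+; toℚᵘ-fromℚᵘ; fromℚᵘ-toℚᵘ; fromℚᵘ-cong)
  using (*-assoc; *-identityʳ; *-distribʳ-+)
open import Data.Rational.Solver using (module +-*-Solver)
import Data.Rational.Unnormalised as ℚᵘ
import Data.Rational.Unnormalised.Properties as ℚᵘP
open import Data.Sum using (inj₁; inj₂)
open import Relation.Nullary using (¬_)
open import Relation.Binary.PropositionalEquality

⟦_⟧ : ℕ → ℚ
⟦ n ⟧ = + n ℚ./ 1

fromℚᵘ-homo-* : ∀ x y → fromℚᵘ x * fromℚᵘ y ≡ fromℚᵘ (x ℚᵘ.* y)
fromℚᵘ-homo-* x y = trans (sym (fromℚᵘ-toℚᵘ _)) (fromℚᵘ-cong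
  (ℚᵘP.≃-trans (toℚᵘ-homo-* (fromℚᵘ x) (fromℚᵘ y))
               (ℚᵘP.*-cong (toℚᵘ-fromℚᵘ x) (toℚᵘ-fromℚᵘ y))))

fromℚᵘ-homo-+ : ∀ x y → fromℚᵘ x ℚ.+ fromℚᵘ y ≡ fromℚᵘ (x ℚᵘ.+ y)
fromℚᵘ-homo-+ x y = trans (sym (fromℚᵘ-toℚᵘ _)) (fromℚᵘ-cong
  (ℚᵘP.≃-trans (toℚᵘ-homo-+ (fromℚᵘ x) (fromℚᵘ y))
               (ℚᵘP.+-cong (toℚᵘ-fromℚᵘ x) (toℚᵘ-fromℚᵘ y))))

⟦⟧-homo-* : ∀ m n → ⟦ m ⟧ * ⟦ n ⟧ ≡ ⟦ m · n ⟧
⟦⟧-homo-* m n = trans (fromℚᵘ-homo-* (+ m ℚᵘ./ 1) (+ n ℚᵘ./ 1))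
  (cong (ℚ._/ 1) (sym (pos-* m n)))

⟦⟧-homo-+ : ∀ m n → ⟦ m ⟧ ℚ.+ ⟦ n ⟧ ≡ ⟦ m + n ⟧
⟦⟧-homo-+ m n = trans (fromℚᵘ-homo-+ (+ m ℚᵘ./ 1) (+ n ℚᵘ./ 1))
  (cong (ℚ._/ 1) (trans (times-one (+ m) (+ n)) (sym (pos-+ m n))))
  where
  times-one : ∀ a b → a ℤ.* + 1 ℤ.+ b ℤ.* + 1 ≡ a ℤ.+ b
  times-one = ℤSolver.solve-∀

/-*-cancel : ∀ i d .{{_ : NonZero d}} → (i ℚ./ d) * ⟦ d ⟧ ≡ i ℚ./ 1
/-*-cancel i (suc d) = trans (fromℚᵘ-homo-* (i ℚᵘ./ suc d) (+ suc d ℚᵘ./ 1))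
  (fromℚᵘ-cong {(i ℚᵘ./ suc d) ℚᵘ.* (+ suc d ℚᵘ./ 1)} {i ℚᵘ./ 1}
                (ℚᵘ.*≡* (cancel i (+ suc d))))
  where
  cancel : ∀ a b → a ℤ.* b ℤ.* + 1 ≡ a ℤ.* (b ℤ.* + 1)
  cancel = ℤSolver.solve-∀

term-cleared : ∀ a b c k m e →
  multinom3 a b c * inv27^ k * invSuc m * ⟦ a ! · b ! · c ! · 27 ^ k · suc m · e ⟧
    ≡ ⟦ (a + b + c) ! · e ⟧
term-cleared a b c k m e = begin
  M * P⁻¹ * q⁻¹ * ⟦ F · P · q · e ⟧
    ≡⟨ cong (M * P⁻¹ * q⁻¹ *_) split ⟨
  M * P⁻¹ * q⁻¹ * (⟦ F ⟧ * ⟦ P ⟧ * ⟦ q ⟧ * ⟦ e ⟧)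
    ≡⟨ rearrange M P⁻¹ q⁻¹ ⟦ F ⟧ ⟦ P ⟧ ⟦ q ⟧ ⟦ e ⟧ ⟩
  (M * ⟦ F ⟧) * (P⁻¹ * ⟦ P ⟧) * (q⁻¹ * ⟦ q ⟧) * ⟦ e ⟧
    ≡⟨ cong (λ x → x * (P⁻¹ * ⟦ P ⟧) * (q⁻¹ * ⟦ q ⟧) * ⟦ e ⟧) (/-*-cancel (+ X) F) ⟩
  ⟦ X ⟧ * (P⁻¹ * ⟦ P ⟧) * (q⁻¹ * ⟦ q ⟧) * ⟦ e ⟧
    ≡⟨ cong (λ x → ⟦ X ⟧ * x * (q⁻¹ * ⟦ q ⟧) * ⟦ e ⟧) (/-*-cancel (+ 1) P) ⟩
  ⟦ X ⟧ * ℚ.1ℚ * (q⁻¹ * ⟦ q ⟧) * ⟦ e ⟧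
    ≡⟨ cong (λ x → ⟦ X ⟧ * ℚ.1ℚ * x * ⟦ e ⟧) (/-*-cancel (+ 1) q) ⟩
  ⟦ X ⟧ * ℚ.1ℚ * ℚ.1ℚ * ⟦ e ⟧
    ≡⟨ cong (_* ⟦ e ⟧) (trans (*-identityʳ (⟦ X ⟧ * ℚ.1ℚ)) (*-identityʳ ⟦ X ⟧)) ⟩
  ⟦ X ⟧ * ⟦ e ⟧
    ≡⟨ ⟦⟧-homo-* X e ⟩
  ⟦ X · e ⟧ ∎
  where
  open ≡-Reasoning
  M P⁻¹ q⁻¹ : ℚ
  M   = multinom3 a b c
  P⁻¹ = inv27^ k
  q⁻¹ = invSuc m
  F P q X : ℕ
  F = a ! · b ! · c !
  P = 27 ^ k
  q = suc m
  X = (a + b + c) !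
  instance
    F≢0 : NonZero F
    F≢0 = m*n≢0 (a ! · b !) (c !) {{m*n≢0 (a !) (b !) {{a !≢0}} {{b !≢0}}}} {{c !≢0}}
    P≢0 : NonZero P
    P≢0 = m^n≢0 27 k
  split : ⟦ F ⟧ * ⟦ P ⟧ * ⟦ q ⟧ * ⟦ e ⟧ ≡ ⟦ F · P · q · e ⟧
  split = begin
    ⟦ F ⟧ * ⟦ P ⟧ * ⟦ q ⟧ * ⟦ e ⟧   ≡⟨ cong (λ x → x * ⟦ q ⟧ * ⟦ e ⟧) (⟦⟧-homo-* F P) ⟩
    ⟦ F · P ⟧ * ⟦ q ⟧ * ⟦ e ⟧     ≡⟨ cong (_* ⟦ e ⟧) (⟦⟧-homo-* (F · P) q) ⟩
    ⟦ F · P · q ⟧ * ⟦ e ⟧       ≡⟨ ⟦⟧-homo-* (F · P · q) e ⟩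
    ⟦ F · P · q · e ⟧ ∎
  rearrange : ∀ x y z u v w t → x * y * z * (u * v * w * t) ≡ (x * u) * (y * v) * (z * w) * t
  rearrange = +-*-Solver.solve 7
    (λ x y z u v w t → x :* y :* z :* (u :* v :* w :* t) := (x :* u) :* (y :* v) :* (z :* w) :* t) refl
    where open +-*-Solver using (_:*_; _:=_)

sumTo-closedForm : (f : ℕ → ℚ) (D N r T : ℕ → ℕ) →
  (∀ k → f k * ⟦ D k ⟧ ≡ ⟦ T k ⟧) →
  (∀ n → D (suc n) ≡ D n · r n) →
  N 0 ≡ T 0 →
  (∀ n → N (suc n) ≡ N n · r n + T (suc n)) →
  ∀ n → sumTo n f * ⟦ D n ⟧ ≡ ⟦ N n ⟧
sumTo-closedForm f D N r T cleared D-step N-zero N-step = closed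
  where
  open ≡-Reasoning
  closed : ∀ n → sumTo n f * ⟦ D n ⟧ ≡ ⟦ N n ⟧
  closed zero = trans (cleared 0) (cong ⟦_⟧ (sym N-zero))
  closed (suc n) = begin
    (S ℚ.+ f (suc n)) * ⟦ D (suc n) ⟧              ≡⟨ *-distribʳ-+ ⟦ D (suc n) ⟧ S (f (suc n)) ⟩
    S * ⟦ D (suc n) ⟧ ℚ.+ f (suc n) * ⟦ D (suc n) ⟧ ≡⟨ cong₂ ℚ._+_ previous (cleared (suc n)) ⟩
    ⟦ N n · r n ⟧ ℚ.+ ⟦ T (suc n) ⟧               ≡⟨ ⟦⟧-homo-+ (N n · r n) (T (suc n)) ⟩
    ⟦ N n · r n + T (suc n) ⟧                     ≡⟨ cong ⟦_⟧ (N-step n) ⟨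
    ⟦ N (suc n) ⟧ ∎
    where
    S : ℚ
    S = sumTo n f
    previous : S * ⟦ D (suc n) ⟧ ≡ ⟦ N n · r n ⟧
    previous = begin
      S * ⟦ D (suc n) ⟧         ≡⟨ cong (λ d → S * ⟦ d ⟧) (D-step n) ⟩
      S * ⟦ D n · r n ⟧       ≡⟨ cong (S *_) (⟦⟧-homo-* (D n) (r n)) ⟨
      S * (⟦ D n ⟧ * ⟦ r n ⟧)   ≡⟨ *-assoc S ⟦ D n ⟧ ⟦ r n ⟧ ⟨
      S * ⟦ D n ⟧ * ⟦ r n ⟧     ≡⟨ cong (_* ⟦ r n ⟧) (closed n) ⟩
      ⟦ N n ⟧ * ⟦ r n ⟧         ≡⟨ ⟦⟧-homo-* (N n) (r n) ⟩
      ⟦ N n · r n ⟧ ∎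

closedForm⇒≡0modℚ : ∀ {p} x D N → x * ⟦ D ⟧ ≡ ⟦ N ⟧ → ¬ p ∣ D → p ∣ N → ≡0modℚ p x
closedForm⇒≡0modℚ x D N x*D≡N p∤D p∣N = + N , + D , p∤D , p∣N , x*D≡N

∣-! : ∀ {p m} .{{_ : NonZero p}} → p ≤ m → p ∣ m !
∣-! {suc p} p≤m = ∣-trans (m∣m*n (p !)) (m≤n⇒m!∣n! p≤m)

module _ {p : ℕ} (p-prime : Prime p) where

  ∤-* : ∀ {a b} → ¬ p ∣ a → ¬ p ∣ b → ¬ p ∣ a · b
  ∤-* {a} {b} p∤a p∤b p∣ab with euclidsLemma a b p-prime p∣ab
  ... | inj₁ p∣a = p∤a p∣a
  ... | inj₂ p∣b = p∤b p∣b

  ∤-1 : ¬ p ∣ 1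
  ∤-1 = >⇒∤ (ℕ.nonTrivial⇒n>1 p {{prime⇒nonTrivial p-prime}})

  ∤-^ : ∀ {a} k → ¬ p ∣ a → ¬ p ∣ a ^ k
  ∤-^ zero    _   = ∤-1
  ∤-^ (suc k) p∤a = ∤-* p∤a (∤-^ k p∤a)

  ∤-! : ∀ m → m < p → ¬ p ∣ m !
  ∤-! zero    _   = ∤-1
  ∤-! (suc m) m<p = ∤-* (>⇒∤ m<p) (∤-! m (ℕP.<-trans (ℕP.n<1+n m) m<p))

-- m lies below the multiple n·(⌊m/n⌋+1); for n = 3 this is what makes
-- 3(⌊m/3⌋+1) reach p in the congruences below.
m<n*[1+m/n] : ∀ m n .{{_ : NonZero n}} → m < n · suc (m / n)
m<n*[1+m/n] m n = begin-strict
  m                  ≡⟨ m≡m%n+[m/n]*n m n ⟩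
  m % n + m / n · n  <⟨ ℕP.+-monoˡ-< (m / n · n) (m%n<n m n) ⟩
  n + m / n · n      ≡⟨ ℕP.*-comm (suc (m / n)) n ⟩
  n · suc (m / n)    ∎
  where open ℕP.≤-Reasoning

-- The denominator
-- denom₁ k is the summand's own denominator k!³·27^k·(k+1) times the factor
-- 2(k+1)²·27, which turns the summand into cleared₁ k; ratio₁ n is
-- denom₁ (n+1) / denom₁ n.
term₁ : ℕ → ℚ
term₁ k = multinom3 k k k * inv27^ k * invSuc k

denom₁ numer₁ ratio₁ cleared₁ : ℕ → ℕ
denom₁ n   = 2 · (suc n ! · suc n ! · suc n ! · 27 ^ suc n)
numer₁ n   = 9 · (suc n · (3 · suc n) !)
ratio₁ n   = suc (suc n) · suc (suc n) · suc (suc n) · 27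
cleared₁ k = (k + k + k) ! · (2 · (suc k · suc k · 27))

closedForm₁ : ∀ n → sumTo n term₁ * ⟦ denom₁ n ⟧ ≡ ⟦ numer₁ n ⟧
closedForm₁ = sumTo-closedForm term₁ denom₁ numer₁ ratio₁ cleared₁
                term₁-cleared denom₁-step refl numer₁-step
  where
  open ≡-Reasoning
  term₁-cleared : ∀ k → term₁ k * ⟦ denom₁ k ⟧ ≡ ⟦ cleared₁ k ⟧
  term₁-cleared k =
    trans (cong (λ d → term₁ k * ⟦ d ⟧) (split k (k !) (27 ^ k))) (term-cleared k k k k k _)
    where
    split : ∀ k F P → 2 · ((suc k · F) · (suc k · F) · (suc k · F) · (27 · P))
                      ≡ F · F · F · P · suc k · (2 · (suc k · suc k · 27))
    split = ℕSolver.solve-∀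
  denom₁-step : ∀ n → denom₁ (suc n) ≡ denom₁ n · ratio₁ n
  denom₁-step n = grow n (suc n !) (27 ^ suc n)
    where
    grow : ∀ n F P → 2 · ((suc (suc n) · F) · (suc (suc n) · F) · (suc (suc n) · F) · (27 · P))
                     ≡ 2 · (F · F · F · P) · (suc (suc n) · suc (suc n) · suc (suc n) · 27)
    grow = ℕSolver.solve-∀
  -- (3n+6)! = (3n+6)(3n+5)(3n+4)·(3n+3)!, and (3n+5)(3n+4) = 9(n+1)(n+2) + 2.
  numer₁-step : ∀ n → numer₁ (suc n) ≡ numer₁ n · ratio₁ n + cleared₁ (suc n)
  numer₁-step n = begin
    9 · (suc (suc n) · (3 · suc (suc n)) !)
      ≡⟨ cong (λ x → 9 · (suc (suc n) · x !)) (three-more n) ⟩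
    9 · (suc (suc n) · (3 + 3 · suc n) !)
      ≡⟨ recurrence n ((3 · suc n) !) ⟩
    numer₁ n · ratio₁ n + (3 · suc n) ! · (2 · (suc (suc n) · suc (suc n) · 27))
      ≡⟨ cong (λ x → numer₁ n · ratio₁ n + x ! · (2 · (suc (suc n) · suc (suc n) · 27))) (thrice n) ⟨
    numer₁ n · ratio₁ n + cleared₁ (suc n) ∎
    where
    three-more : ∀ n → 3 · suc (suc n) ≡ 3 + 3 · suc n
    three-more = ℕSolver.solve-∀
    thrice : ∀ n → suc n + suc n + suc n ≡ 3 · suc n
    thrice = ℕSolver.solve-∀
    recurrence : ∀ n F →
      9 · (suc (suc n) · ((3 + 3 · suc n) · ((2 + 3 · suc n) · ((1 + 3 · suc n) · F))))
        ≡ 9 · (suc n · F) · (suc (suc n) · suc (suc n) · suc (suc n) · 27)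
          + F · (2 · (suc (suc n) · suc (suc n) · 27))
    recurrence = ℕSolver.solve-∀

-- Second series:  sumTo n term₂ · denom₂ n = numer₂ n.  Here denom₂ k is
-- the summand's denominator k!²(k+1)!·27^k·(k+2) times 8(k+1)²·27.
term₂ : ℕ → ℚ
term₂ k = multinom3 k k (k + 1) * inv27^ k * invSuc (k + 1)

denom₂ numer₂ ratio₂ cleared₂ : ℕ → ℕ
denom₂ n   = 8 · (suc n ! · suc n ! · suc (suc n) ! · 27 ^ suc n)
numer₂ n   = 9 · (suc n · (1 + 3 · suc n) !)
ratio₂ n   = suc (suc n) · suc (suc n) · suc (suc (suc n)) · 27
cleared₂ k = (k + k + (k + 1)) ! · (8 · (suc k · suc k · 27))

closedForm₂ : ∀ n → sumTo n term₂ * ⟦ denom₂ n ⟧ ≡ ⟦ numer₂ n ⟧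
closedForm₂ = sumTo-closedForm term₂ denom₂ numer₂ ratio₂ cleared₂
                term₂-cleared denom₂-step refl numer₂-step
  where
  open ≡-Reasoning
  term₂-cleared : ∀ k → term₂ k * ⟦ denom₂ k ⟧ ≡ ⟦ cleared₂ k ⟧
  term₂-cleared k =
    trans (cong (λ d → term₂ k * ⟦ d ⟧) denom₂-split) (term-cleared k k (k + 1) k (k + 1) _)
    where
    e : ℕ
    e = 8 · (suc k · suc k · 27)
    split : ∀ k F P → 8 · ((suc k · F) · (suc k · F) · (suc (suc k) · (suc k · F)) · (27 · P))
                      ≡ F · F · (suc k · F) · P · suc (k + 1) · (8 · (suc k · suc k · 27))
    split = ℕSolver.solve-∀
    -- The denominator of the summand contains (k+1)!, which is (1+k)! = (k+1)·k!.
    denom₂-split : denom₂ k ≡ k ! · k ! · (k + 1) ! · 27 ^ k · suc (k + 1) · e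
    denom₂-split = trans (split k (k !) (27 ^ k))
      (sym (cong (λ x → k ! · k ! · x ! · 27 ^ k · suc (k + 1) · e) (+-comm k 1)))
  denom₂-step : ∀ n → denom₂ (suc n) ≡ denom₂ n · ratio₂ n
  denom₂-step n = grow n (suc n !) (27 ^ suc n)
    where
    grow : ∀ n F P →
      8 · ((suc (suc n) · F) · (suc (suc n) · F) · (suc (suc (suc n)) · (suc (suc n) · F)) · (27 · P))
        ≡ 8 · (F · F · (suc (suc n) · F) · P) · (suc (suc n) · suc (suc n) · suc (suc (suc n)) · 27)
    grow = ℕSolver.solve-∀
  -- (3n+7)! = (3n+7)(3n+6)(3n+5)·(3n+4)!, and (3n+7)(3n+5) = 9(n+1)(n+3) + 8.
  numer₂-step : ∀ n → numer₂ (suc n) ≡ numer₂ n · ratio₂ n + cleared₂ (suc n)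
  numer₂-step n = begin
    9 · (suc (suc n) · (1 + 3 · suc (suc n)) !)
      ≡⟨ cong (λ x → 9 · (suc (suc n) · x !)) (three-more n) ⟩
    9 · (suc (suc n) · (3 + (1 + 3 · suc n)) !)
      ≡⟨ recurrence n ((1 + 3 · suc n) !) ⟩
    numer₂ n · ratio₂ n + (1 + 3 · suc n) ! · (8 · (suc (suc n) · suc (suc n) · 27))
      ≡⟨ cong (λ x → numer₂ n · ratio₂ n + x ! · (8 · (suc (suc n) · suc (suc n) · 27))) (thrice n) ⟨
    numer₂ n · ratio₂ n + cleared₂ (suc n) ∎
    where
    three-more : ∀ n → 1 + 3 · suc (suc n) ≡ 3 + (1 + 3 · suc n)
    three-more = ℕSolver.solve-∀
    thrice : ∀ n → suc n + suc n + (suc n + 1) ≡ 1 + 3 · suc n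
    thrice = ℕSolver.solve-∀
    recurrence : ∀ n G →
      9 · (suc (suc n) · ((3 + (1 + 3 · suc n)) · ((2 + (1 + 3 · suc n)) · ((1 + (1 + 3 · suc n)) · G))))
        ≡ 9 · (suc n · G) · (suc (suc n) · suc (suc n) · suc (suc (suc n)) · 27)
          + G · (8 · (suc (suc n) · suc (suc n) · 27))
    recurrence = ℕSolver.solve-∀

5≤⇒∤2 : ∀ {p} → 5 ≤ p → ¬ p ∣ 2
5≤⇒∤2 5≤p = >⇒∤ (ℕP.≤-trans (ℕP.m≤m+n 3 2) 5≤p)

5≤⇒∤3 : ∀ {p} → 5 ≤ p → ¬ p ∣ 3
5≤⇒∤3 5≤p = >⇒∤ (ℕP.≤-trans (ℕP.m≤m+n 4 1) 5≤p)

-- The first congruence: take n = ⌊(p-1)/3⌋, so that n+1 < p ≤ 3n+3.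
sum₁-≡0modℚ : ∀ p → Prime p → 5 ≤ p → ≡0modℚ p (sumTo ((p ∸ 1) / 3) term₁)
sum₁-≡0modℚ (suc m) p-prime 5≤p@(s≤s (s≤s _)) =
  closedForm⇒≡0modℚ (sumTo n term₁) (denom₁ n) (numer₁ n) (closedForm₁ n) p∤denom p∣numer
  where
  n : ℕ
  n = m / 3
  p∤n+1! : ¬ suc m ∣ suc n !
  p∤n+1! = ∤-! p-prime (suc n) (s≤s (m/n<m m 3 (s≤s (s≤s z≤n))))
  p∤27^ : ¬ suc m ∣ 27 ^ suc n
  p∤27^ = ∤-^ p-prime (suc n) (∤-^ p-prime 3 (5≤⇒∤3 5≤p))
  p∤denom : ¬ suc m ∣ denom₁ n
  p∤denom = ∤-* p-prime (5≤⇒∤2 5≤p)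
              (∤-* p-prime (∤-* p-prime (∤-* p-prime p∤n+1! p∤n+1!) p∤n+1!) p∤27^)
  p∣numer : suc m ∣ numer₁ n
  p∣numer = ∣n⇒∣m*n 9 (∣n⇒∣m*n (suc n) (∣-! (m<n*[1+m/n] m 3)))

-- The second congruence: take n = ⌊(p-2)/3⌋, so that n+2 < p ≤ 3n+4.
sum₂-≡0modℚ : ∀ p → Prime p → 5 ≤ p → ≡0modℚ p (sumTo ((p ∸ 2) / 3) term₂)
sum₂-≡0modℚ (suc (suc m)) p-prime 5≤p@(s≤s (s≤s (s≤s _))) =
  closedForm⇒≡0modℚ (sumTo n term₂) (denom₂ n) (numer₂ n) (closedForm₂ n) p∤denom p∣numer
  where
  n : ℕ
  n = m / 3
  n<m : n < m
  n<m = m/n<m m 3 (s≤s (s≤s z≤n))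
  p∤n+1! : ¬ suc (suc m) ∣ suc n !
  p∤n+1! = ∤-! p-prime (suc n) (s≤s (ℕP.m≤n⇒m≤1+n n<m))
  p∤n+2! : ¬ suc (suc m) ∣ suc (suc n) !
  p∤n+2! = ∤-! p-prime (suc (suc n)) (s≤s (s≤s n<m))
  p∤27^ : ¬ suc (suc m) ∣ 27 ^ suc n
  p∤27^ = ∤-^ p-prime (suc n) (∤-^ p-prime 3 (5≤⇒∤3 5≤p))
  p∤denom : ¬ suc (suc m) ∣ denom₂ n
  p∤denom = ∤-* p-prime (∤-^ p-prime 3 (5≤⇒∤2 5≤p))
              (∤-* p-prime (∤-* p-prime (∤-* p-prime p∤n+1! p∤n+1!) p∤n+2!) p∤27^)
  p∣numer : suc (suc m) ∣ numer₂ n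
  p∣numer = ∣n⇒∣m*n 9 (∣n⇒∣m*n (suc n) (∣-! (s≤s (m<n*[1+m/n] m 3))))

corollary2p2 : (p : ℕ) → Prime p → 5 ≤ p →
    ≡0modℚ p (sumTo ((p ∸ 1) / 3) (λ k → multinom3 k k k * inv27^ k * invSuc k))
    × ≡0modℚ p (sumTo ((p ∸ 2) / 3) (λ k → multinom3 k k (k + 1) * inv27^ k * invSuc (k + 1)))
corollary2p2 p p-prime 5≤p = sum₁-≡0modℚ p p-prime 5≤p , sum₂-≡0modℚ p p-prime 5≤p
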